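{- Let $a\in\mathbb{N}$ with $a\geq 3$, and let $S(a)$ be the submonoid of $(\mathbb{N},+)$ generated by $\{f_a+f_n\mid n\in\mathbb{N}\}$. Then $\mathrm{g}(S(a))=\sum_{x=1}^{f_a-1}\beta(x)$.
   Context: $\{f_n\}$ is the Fibonacci sequence ($f_0=0$, $f_1=1$, $f_{n+2}=f_{n+1}+f_n$). $\mathrm{g}(S)$ is the cardinality of $\mathbb{N}\setminus S$. For $x\in\mathbb{N}$, $\beta(x)=\min\{\sum_{i=2}^{l} b_i \mid x=\sum_{i=2}^{l} b_i f_i,\ (b_2,\ldots,b_l)\in\mathbb{N}^{l-1},\ l\geq 2\}$. -}

module Defs where

open import Data.Nat using (ℕ; zero; suc; _+_; _*_; _∸_; _≤_)
open import Data.List using (List; []; _∷_; length)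
open import Data.Nat.ListAction using (sum)
open import Data.List.Relation.Unary.Unique.Propositional using (Unique)
open import Data.List.Membership.Propositional using (_∈_)
open import Data.Product using (Σ; _×_; _,_)
open import Relation.Nullary using (¬_)
open import Relation.Binary.PropositionalEquality using (_≡_)

fib : ℕ → ℕ
fib zero = zero
fib (suc zero) = suc zero
fib (suc (suc n)) = fib (suc n) + fib n

data InS (a : ℕ) : ℕ → Set where
  s-zero : InS a zero
  s-gen  : (n : ℕ) → InS a (fib a + fib n)
  s-add  : {x y : ℕ} → InS a x → InS a y → InS a (x + y)

HasGenus : (ℕ → Set) → ℕ → Set
HasGenus S g = Σ (List ℕ) λ L → Unique L × ((x : ℕ) → (x ∈ L → ¬ S x) × (¬ S x → x ∈ L)) × length L ≡ g

fibWeighted : ℕ → List ℕ → ℕ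
fibWeighted k [] = zero
fibWeighted k (b ∷ bs) = b * fib k + fibWeighted (suc k) bs

-- x = Σ_{i=2}^{l} b_i f_i with Σ b_i = k   (bs = (b_2, …, b_l))
Rep : ℕ → ℕ → Set
Rep x k = Σ (List ℕ) λ bs → fibWeighted 2 bs ≡ x × sum bs ≡ k

IsBeta : ℕ → ℕ → Set
IsBeta x k = Rep x k × ((k' : ℕ) → Rep x k' → k ≤ k')

sumFrom1 : (ℕ → ℕ) → ℕ → ℕ
sumFrom1 h zero = zero
sumFrom1 h (suc m) = sumFrom1 h m + h (suc m)

module Submission where

-- Put F = f_a. As f_0 = 0 is a summand of no cost, the elements of S(a) are exactly the numbers
-- k F + f_{n_1} + ... + f_{n_k}, and for x = q F + r with r < F this says: x ∈ S(a) iff β(r) ≤ q.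
-- Padding a shortest Fibonacci representation of r with copies of f_0 gives one direction.
-- For the other, split each f_n with n > a + 1 into copies of f_a and f_{a+1}, each at least F;
-- then subtract F repeatedly.  This never increases the number of summands: from a sum of
-- Fibonacci numbers with indices at most m + 1 and value at least f_m one takes f_m out by
-- trading an f_{m+1} for f_{m-1}, by dropping an f_m, or, when all indices are below m, by
-- taking out f_{m-1} and then f_{m-2}; in the last two cases one summand is lost.
-- Hence the gaps with residue r are r, r + F, ..., r + (β(r) - 1) F, and there are
-- β(1) + ... + β(F - 1) of them.  The same extraction shows that β is computed greedily.

open import Defs
open import Data.Nat
  using (ℕ; zero; suc; _+_; _*_; _∸_; _≤_; _<_; z≤n; s≤s; s≤s⁻¹; _≤?_; _<?_; _≟_
        ; NonZero; >-nonZero)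
open import Data.Nat.Properties
open import Algebra.Properties.CommutativeSemigroup +-commutativeSemigroup
  using (interchange; x∙yz≈y∙xz; xy∙z≈y∙zx)
open import Data.Nat.DivMod
  using (_/_; _%_; m≡m%n+[m/n]*n; m%n<n; m/n*n≤m; [m+kn]%n≡m%n; m<n⇒m%n≡m; m*n/n≡m; m<n⇒m/n≡0
        ; /-monoˡ-≤; +-distrib-/-∣ˡ)
open import Data.Nat.Divisibility using (divides-refl)
open import Data.Nat.Induction using (<-rec)
open import Data.Nat.ListAction using (sum)
open import Data.Nat.ListAction.Properties using (sum-++; sum-↭)
open import Data.List using (List; []; _∷_; [_]; _++_; length; map; replicate; upTo)
open import Data.List.Properties using (length-++; length-replicate; map-++; length-map; length-upTo)
open import Data.List.Relation.Unary.All as All using (All; []; _∷_)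
open import Data.List.Relation.Unary.All.Properties using (¬Any⇒All¬; ++⁺)
open import Data.List.Membership.Propositional using (_∈_; _∉_)
open import Data.List.Membership.Propositional.Properties
  using (∈-∃++; ∈-++⁻; ∈-++⁺ˡ; ∈-++⁺ʳ; ∈-map⁻; ∈-map⁺; ∈-upTo⁻; ∈-upTo⁺)
open import Data.List.Membership.DecPropositional _≟_ using (_∈?_)
open import Data.List.Relation.Binary.Permutation.Propositional using (_↭_)
import Data.List.Relation.Binary.Permutation.Propositional.Properties as ↭
open import Data.List.Relation.Unary.Unique.Propositional using (Unique)
import Data.List.Relation.Unary.Unique.Propositional.Properties as Unique
open import Data.Product using (Σ; ∃; _×_; _,_; proj₁; proj₂)
open import Data.Sum using (inj₁; inj₂)
open import Function using (_∘_; id)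
open import Relation.Nullary using (¬_; yes; no; contradiction)
open import Relation.Binary.PropositionalEquality
  using (_≡_; refl; sym; trans; cong; cong₂; subst; subst₂; module ≡-Reasoning)

fib-≤-suc : ∀ n → fib n ≤ fib (suc n)
fib-≤-suc zero          = z≤n
fib-≤-suc (suc zero)    = ≤-refl
fib-≤-suc (suc (suc n)) = m≤m+n _ _

fib-mono : ∀ {m n} → m ≤ n → fib m ≤ fib n
fib-mono {n = zero} z≤n = ≤-refl
fib-mono {m} {suc n} m≤1+n with m≤n⇒m<n∨m≡n m≤1+n
... | inj₁ m<1+n = ≤-trans (fib-mono (s≤s⁻¹ m<1+n)) (fib-≤-suc n)
... | inj₂ refl  = ≤-refl

fib-suc-pos : ∀ n → 0 < fib (suc n)
fib-suc-pos n = fib-mono {1} {suc n} (s≤s z≤n)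

fib<⇒≤ : ∀ {m n} → fib m < fib (suc n) → m ≤ n
fib<⇒≤ fm< = ≮⇒≥ (λ n<m → <⇒≱ fm< (fib-mono n<m))

[q*n+r]%n≡r : ∀ q {n r} .{{_ : NonZero n}} → r < n → (q * n + r) % n ≡ r
[q*n+r]%n≡r q {n} {r} r<n = begin
  (q * n + r) % n ≡⟨ cong (_% n) (+-comm (q * n) r) ⟩
  (r + q * n) % n ≡⟨ [m+kn]%n≡m%n r q n ⟩
  r % n           ≡⟨ m<n⇒m%n≡m r<n ⟩
  r               ∎
  where open ≡-Reasoning

[q*n+r]/n≡q : ∀ q {n r} .{{_ : NonZero n}} → r < n → (q * n + r) / n ≡ q
[q*n+r]/n≡q q {n} {r} r<n = begin
  (q * n + r) / n   ≡⟨ +-distrib-/-∣ˡ r (divides-refl q) ⟩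
  q * n / n + r / n ≡⟨ cong₂ _+_ (m*n/n≡m q n) (m<n⇒m/n≡0 r<n) ⟩
  q + 0             ≡⟨ +-identityʳ q ⟩
  q                 ∎
  where open ≡-Reasoning

<⇒≤∸1 : ∀ {m n} → m < n → m ≤ n ∸ 1
<⇒≤∸1 (s≤s m≤n) = m≤n

n∸1<n : ∀ n .{{_ : NonZero n}} → n ∸ 1 < n
n∸1<n (suc n) = n<1+n n

fibSum : List ℕ → ℕ
fibSum L = sum (map fib L)

fibSum-++ : ∀ L M → fibSum (L ++ M) ≡ fibSum L + fibSum M
fibSum-++ L M = trans (cong sum (map-++ fib L M)) (sum-++ (map fib L) (map fib M))

fibSum-↭ : ∀ {L M} → L ↭ M → fibSum L ≡ fibSum M
fibSum-↭ L↭M = sum-↭ (↭.map⁺ fib L↭M)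

fibSum-replicate : ∀ b i → fibSum (replicate b i) ≡ b * fib i
fibSum-replicate zero    i = refl
fibSum-replicate (suc b) i = cong (fib i +_) (fibSum-replicate b i)

fibSum-zeros : ∀ {L} → All (_≤ 0) L → fibSum L ≡ 0
fibSum-zeros []          = refl
fibSum-zeros (z≤n ∷ L≤0) = fibSum-zeros L≤0

length*fib≤fibSum : ∀ {k L} → All (k ≤_) L → length L * fib k ≤ fibSum L
length*fib≤fibSum []          = z≤n
length*fib≤fibSum (k≤i ∷ k≤L) = +-mono-≤ (fib-mono k≤i) (length*fib≤fibSum k≤L)

fibSum<⇒indices≤ : ∀ k L → fibSum L < fib (suc k) → All (_≤ k) L
fibSum<⇒indices≤ k []      _ = []
fibSum<⇒indices≤ k (i ∷ L) h =
  fib<⇒≤ (≤-<-trans (m≤m+n _ _) h) ∷ fibSum<⇒indices≤ k L (≤-<-trans (m≤n+m _ _) h)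

record Removal (δ v : ℕ) (L : List ℕ) : Set where
  constructor removal
  field
    rest        : List ℕ
    fibSum-rest : fibSum rest + v ≡ fibSum L
    length-rest : δ + length rest ≤ length L
    bounded     : ∀ {B} → All (_≤ B) L → All (_≤ B) rest

open Removal

remove-nothing : ∀ {L} → Removal 0 0 L
remove-nothing {L} = removal L (+-identityʳ _) ≤-refl id

forget-strictness : ∀ {v L} → Removal 1 v L → Removal 0 v L
forget-strictness r = removal (rest r) (fibSum-rest r) (<⇒≤ (length-rest r)) (bounded r)

_then_ : ∀ {δ ε u v L} (r : Removal δ u L) → Removal ε v (rest r) → Removal (δ + ε) (u + v) L
_then_ {δ} {ε} {u} {v} {L} r s = removal (rest s) fibSum-eq length-le (bounded s ∘ bounded r)
  where
  fibSum-eq : fibSum (rest s) + (u + v) ≡ fibSum L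
  fibSum-eq = begin
    fibSum (rest s) + (u + v) ≡⟨ cong (fibSum (rest s) +_) (+-comm u v) ⟩
    fibSum (rest s) + (v + u) ≡⟨ +-assoc (fibSum (rest s)) v u ⟨
    fibSum (rest s) + v + u   ≡⟨ cong (_+ u) (fibSum-rest s) ⟩
    fibSum (rest r) + u       ≡⟨ fibSum-rest r ⟩
    fibSum L                  ∎
    where open ≡-Reasoning
  length-le : δ + ε + length (rest s) ≤ length L
  length-le = begin
    δ + ε + length (rest s)   ≡⟨ +-assoc δ ε _ ⟩
    δ + (ε + length (rest s)) ≤⟨ +-monoʳ-≤ δ (length-rest s) ⟩
    δ + length (rest r)       ≤⟨ length-rest r ⟩
    length L                  ∎
    where open ≤-Reasoning

≤-fibSum-rest : ∀ {δ v w L} (r : Removal δ v L) → v + w ≤ fibSum L → w ≤ fibSum (rest r)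
≤-fibSum-rest {v = v} {w} r h =
  +-cancelʳ-≤ v w _ (subst₂ _≤_ (+-comm v w) (sym (fibSum-rest r)) h)

remove-member : ∀ {m L} → m ∈ L → Removal 1 (fib m) L
remove-member {m} m∈L with ∈-∃++ m∈L
... | ys , zs , refl =
  removal (ys ++ zs)
    (trans (+-comm (fibSum (ys ++ zs)) (fib m)) (sym (fibSum-↭ σ)))
    (≤-reflexive (sym (↭.↭-length σ)))
    (All.tail ∘ ↭.All-resp-↭ σ)
  where
  σ : ys ++ [ m ] ++ zs ↭ m ∷ ys ++ zs
  σ = ↭.shift m ys zs

remove-by-trading : ∀ {m L} → suc (suc m) ∈ L → Removal 0 (fib (suc m)) L
remove-by-trading {m} {L} m+2∈L =
  removal (m ∷ rest r) fibSum-eq (length-rest r)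
    λ L≤ → ≤-trans (m≤n+m m 2) (All.lookup L≤ m+2∈L) ∷ bounded r L≤
  where
  r = remove-member m+2∈L
  fibSum-eq : fib m + fibSum (rest r) + fib (suc m) ≡ fibSum L
  fibSum-eq = trans (xy∙z≈y∙zx (fib m) _ _) (fibSum-rest r)

below-absent : ∀ {m L} → All (_≤ suc m) L → suc m ∉ L → All (_≤ m) L
below-absent L≤ m+1∉L =
  All.zipWith (λ (i≤ , i≢) → s≤s⁻¹ (≤∧≢⇒< i≤ (i≢ ∘ sym))) (L≤ , ¬Any⇒All¬ _ m+1∉L)

mutual
  remove-fib : ∀ m {L} → All (_≤ suc m) L → fib m ≤ fibSum L → Removal 0 (fib m) L
  remove-fib zero    _  _ = remove-nothing
  remove-fib (suc m) {L} L≤ fm≤ with suc (suc m) ∈? L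
  ... | yes m+2∈L = remove-by-trading m+2∈L
  ... | no  m+2∉L = forget-strictness (remove-fib-strictly m (below-absent L≤ m+2∉L) fm≤)

  remove-fib-strictly : ∀ m {L} → All (_≤ suc m) L → fib (suc m) ≤ fibSum L →
                        Removal 1 (fib (suc m)) L
  remove-fib-strictly m {L} L≤ fm≤ with suc m ∈? L
  ... | yes m+1∈L = remove-member m+1∈L
  ... | no  m+1∉L = remove-fib-below m (below-absent L≤ m+1∉L) fm≤

  remove-fib-below : ∀ m {L} → All (_≤ m) L → fib (suc m) ≤ fibSum L →
                     Removal 1 (fib (suc m)) L
  remove-fib-below zero    L≤ f1≤ = contradiction (subst (1 ≤_) (fibSum-zeros L≤) f1≤) λ ()
  remove-fib-below (suc m) L≤ fm≤ = r then remove-fib m (bounded r L≤) (≤-fibSum-rest r fm≤)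
    where r = remove-fib-strictly m L≤ (≤-trans (m≤m+n _ _) fm≤)

fib-bracket : ∀ n → ∃ λ j → fib (suc (suc j)) ≤ suc n × suc n < fib (suc (suc (suc j)))
fib-bracket zero = 0 , ≤-refl , s≤s (s≤s z≤n)
fib-bracket (suc n) with fib-bracket n
... | j , lower , upper with suc (suc n) <? fib (suc (suc (suc j)))
...   | yes upper′ = j , m≤n⇒m≤1+n lower , upper′
...   | no ¬upper′ = suc j , ≤-reflexive (sym n+2≡) , n+2<
  where
  n+2≡ : suc (suc n) ≡ fib (suc (suc (suc j)))
  n+2≡ = ≤-antisym upper (≮⇒≥ ¬upper′)
  n+2< : suc (suc n) < fib (suc (suc (suc (suc j))))
  n+2< = subst (_< fib (suc (suc (suc (suc j))))) (sym n+2≡) (m<m+n _ (fib-suc-pos (suc j)))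

bump : ℕ → List ℕ → List ℕ
bump zero    []       = 1 ∷ []
bump zero    (b ∷ bs) = suc b ∷ bs
bump (suc j) []       = 0 ∷ bump j []
bump (suc j) (b ∷ bs) = b ∷ bump j bs

fibWeighted-bump : ∀ j k bs → fibWeighted k (bump j bs) ≡ fib (j + k) + fibWeighted k bs
fibWeighted-bump zero    k []       = cong (_+ 0) (+-identityʳ (fib k))
fibWeighted-bump zero    k (b ∷ bs) = +-assoc (fib k) (b * fib k) _
fibWeighted-bump (suc j) k []       =
  trans (fibWeighted-bump j (suc k) []) (cong₂ _+_ (cong fib (+-suc j k)) refl)
fibWeighted-bump (suc j) k (b ∷ bs) = begin
  b * fib k + fibWeighted (suc k) (bump j bs)
    ≡⟨ cong (b * fib k +_) (fibWeighted-bump j (suc k) bs) ⟩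
  b * fib k + (fib (j + suc k) + fibWeighted (suc k) bs)
    ≡⟨ x∙yz≈y∙xz (b * fib k) (fib (j + suc k)) _ ⟩
  fib (j + suc k) + (b * fib k + fibWeighted (suc k) bs)
    ≡⟨ cong₂ _+_ (cong fib (+-suc j k)) refl ⟩
  fib (suc j + k) + (b * fib k + fibWeighted (suc k) bs) ∎
  where open ≡-Reasoning

sum-bump : ∀ j bs → sum (bump j bs) ≡ suc (sum bs)
sum-bump zero    []       = refl
sum-bump zero    (b ∷ bs) = refl
sum-bump (suc j) []       = sum-bump j []
sum-bump (suc j) (b ∷ bs) = trans (cong (b +_) (sum-bump j bs)) (+-suc b (sum bs))

Rep-bump : ∀ j {x c} → Rep x c → Rep (fib (suc (suc j)) + x) (suc c)
Rep-bump j (bs , value , count) =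
  bump j bs ,
  trans (fibWeighted-bump j 2 bs) (cong₂ _+_ (cong fib (+-comm j 2)) value) ,
  trans (sum-bump j bs) (cong suc count)

indices : ℕ → List ℕ → List ℕ
indices k []       = []
indices k (b ∷ bs) = replicate b k ++ indices (suc k) bs

fibSum-indices : ∀ k bs → fibSum (indices k bs) ≡ fibWeighted k bs
fibSum-indices k []       = refl
fibSum-indices k (b ∷ bs) =
  trans (fibSum-++ (replicate b k) _) (cong₂ _+_ (fibSum-replicate b k) (fibSum-indices (suc k) bs))

length-indices : ∀ k bs → length (indices k bs) ≡ sum bs
length-indices k []       = refl
length-indices k (b ∷ bs) =
  trans (length-++ (replicate b k)) (cong₂ _+_ (length-replicate b) (length-indices (suc k) bs))

IsMinimalCount : ℕ → ℕ → Set
IsMinimalCount u c = Rep u c × (∀ L → fibSum L ≡ u → c ≤ length L)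

greedy-lower-bound : ∀ j {u c} → fib (suc (suc j)) ≤ u → u < fib (suc (suc (suc j))) →
  (∀ L → fibSum L ≡ u ∸ fib (suc (suc j)) → c ≤ length L) →
  ∀ L → fibSum L ≡ u → suc c ≤ length L
greedy-lower-bound j lower upper minimal L refl =
  ≤-trans (s≤s (minimal (rest r) rest≡)) (length-rest r)
  where
  r = remove-fib-strictly (suc j) (fibSum<⇒indices≤ (suc (suc j)) L upper) lower
  rest≡ : fibSum (rest r) ≡ fibSum L ∸ fib (suc (suc j))
  rest≡ = trans (sym (m+n∸n≡m (fibSum (rest r)) (fib (suc (suc j)))))
                (cong (_∸ fib (suc (suc j))) (fibSum-rest r))

minimalCount : ∀ u → ∃ (IsMinimalCount u)
minimalCount = <-rec _ step
  where
  step : ∀ u → (∀ {v} → v < u → ∃ (IsMinimalCount v)) → ∃ (IsMinimalCount u)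
  step zero    _   = 0 , ([] , refl , refl) , λ _ _ → z≤n
  step (suc n) rec with fib-bracket n
  ... | j , lower , upper with rec (∸-monoʳ-< (fib-suc-pos (suc j)) lower)
  ...   | c , rep , minimal =
    suc c ,
    subst (λ x → Rep x (suc c)) (m+[n∸m]≡n lower) (Rep-bump j rep) ,
    greedy-lower-bound j lower upper minimal

β : ℕ → ℕ
β u = proj₁ (minimalCount u)

β-rep : ∀ u → Rep u (β u)
β-rep u = proj₁ (proj₂ (minimalCount u))

β-minimal : ∀ {u} L → fibSum L ≡ u → β u ≤ length L
β-minimal {u} = proj₂ (proj₂ (minimalCount u))

β-zero : β 0 ≡ 0
β-zero = n≤0⇒n≡0 (β-minimal [] refl)

isBeta : ∀ x → IsBeta x (β x)
isBeta x = β-rep x , λ k (bs , value , count) →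
  subst (β x ≤_) (trans (length-indices 2 bs) count)
    (β-minimal (indices 2 bs) (trans (fibSum-indices 2 bs) value))

β≤⇒indices : ∀ {u q} → β u ≤ q → ∃ λ L → fibSum L ≡ u × length L ≡ q
β≤⇒indices {u} {q} β≤q with β-rep u
... | bs , value , count = indices 2 bs ++ padding , fibSum-eq , length-eq
  where
  padding = replicate (q ∸ β u) 0
  fibSum-eq : fibSum (indices 2 bs ++ padding) ≡ u
  fibSum-eq = begin
    fibSum (indices 2 bs ++ padding)       ≡⟨ fibSum-++ (indices 2 bs) padding ⟩
    fibSum (indices 2 bs) + fibSum padding ≡⟨ cong₂ _+_ (trans (fibSum-indices 2 bs) value)
                                                         (fibSum-replicate (q ∸ β u) 0) ⟩
    u + (q ∸ β u) * 0                      ≡⟨ cong (u +_) (*-zeroʳ (q ∸ β u)) ⟩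
    u + 0                                  ≡⟨ +-identityʳ u ⟩
    u                                      ∎
    where open ≡-Reasoning
  length-eq : length (indices 2 bs ++ padding) ≡ q
  length-eq = trans (length-++ (indices 2 bs))
    (trans (cong₂ _+_ (trans (length-indices 2 bs) count) (length-replicate _)) (m+[n∸m]≡n β≤q))

module Gaps (a : ℕ) .{{_ : NonZero (fib a)}} where

  generatorSum : List ℕ → ℕ
  generatorSum L = length L * fib a + fibSum L

  generatorSum-++ : ∀ L M → generatorSum (L ++ M) ≡ generatorSum L + generatorSum M
  generatorSum-++ L M = begin
    length (L ++ M) * fib a + fibSum (L ++ M)
      ≡⟨ cong₂ _+_ (trans (cong (_* fib a) (length-++ L)) (*-distribʳ-+ (fib a) (length L) _))
                   (fibSum-++ L M) ⟩
    (length L * fib a + length M * fib a) + (fibSum L + fibSum M)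
      ≡⟨ interchange (length L * fib a) (length M * fib a) (fibSum L) (fibSum M) ⟩
    generatorSum L + generatorSum M ∎
    where open ≡-Reasoning

  InS-generatorSum : ∀ L → InS a (generatorSum L)
  InS-generatorSum []      = s-zero
  InS-generatorSum (i ∷ L) =
    subst (InS a) (interchange (fib a) (fib i) _ _) (s-add (s-gen i) (InS-generatorSum L))

  InS⇒generatorSum : ∀ {x} → InS a x → ∃ λ L → generatorSum L ≡ x
  InS⇒generatorSum s-zero      = [] , refl
  InS⇒generatorSum (s-gen n)   = [ n ] , cong₂ _+_ (+-identityʳ (fib a)) (+-identityʳ (fib n))
  InS⇒generatorSum (s-add x y) with InS⇒generatorSum x | InS⇒generatorSum y
  ... | L , refl | M , refl = L ++ M , generatorSum-++ L M

  fibParts : ℕ → List ℕ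
  fibParts zero          = [ a ]
  fibParts (suc zero)    = [ suc a ]
  fibParts (suc (suc j)) = fibParts (suc j) ++ fibParts j

  fibParts-≤ : ∀ j → All (_≤ suc a) (fibParts j)
  fibParts-≤ zero          = n≤1+n a ∷ []
  fibParts-≤ (suc zero)    = ≤-refl ∷ []
  fibParts-≤ (suc (suc j)) = ++⁺ (fibParts-≤ (suc j)) (fibParts-≤ j)

  fibParts-≥ : ∀ j → All (a ≤_) (fibParts j)
  fibParts-≥ zero          = ≤-refl ∷ []
  fibParts-≥ (suc zero)    = n≤1+n a ∷ []
  fibParts-≥ (suc (suc j)) = ++⁺ (fibParts-≥ (suc j)) (fibParts-≥ j)

  fibSum-fibParts : ∀ j → fibSum (fibParts j) ≡ fib (j + a)
  fibSum-fibParts zero          = +-identityʳ _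
  fibSum-fibParts (suc zero)    = +-identityʳ _
  fibSum-fibParts (suc (suc j)) =
    trans (fibSum-++ (fibParts (suc j)) (fibParts j))
          (cong₂ _+_ (fibSum-fibParts (suc j)) (fibSum-fibParts j))

  record Lowering (L : List ℕ) : Set where
    constructor lowering
    field
      lowered        : List ℕ
      lowered-≤      : All (_≤ suc a) lowered
      fibSum-lowered : fibSum lowered ≡ fibSum L
      length-lowered : length lowered * fib a ≤ generatorSum L

  lower-index : ∀ i → Lowering [ i ]
  lower-index i with i ≤? suc a
  ... | yes i≤ = lowering [ i ] (i≤ ∷ []) refl (m≤m+n _ _)
  ... | no  i≰ = lowering (fibParts j) (fibParts-≤ j) fibSum-eq length-le
    where
    j = i ∸ a
    fibSum-parts : fibSum (fibParts j) ≡ fib i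
    fibSum-parts = trans (fibSum-fibParts j) (cong fib (m∸n+n≡m (≤-trans (n≤1+n a) (<⇒≤ (≰⇒> i≰)))))
    fibSum-eq : fibSum (fibParts j) ≡ fib i + 0
    fibSum-eq = trans fibSum-parts (sym (+-identityʳ _))
    length-le : length (fibParts j) * fib a ≤ generatorSum [ i ]
    length-le = ≤-trans (length*fib≤fibSum (fibParts-≥ j))
                        (≤-trans (≤-reflexive fibSum-eq) (m≤n+m (fib i + 0) (fib a + 0)))

  lowering-++ : ∀ {L M} → Lowering L → Lowering M → Lowering (L ++ M)
  lowering-++ {L} {M} (lowering K K≤ K-sum K-len) (lowering N N≤ N-sum N-len) =
    lowering (K ++ N) (++⁺ K≤ N≤)
      (trans (fibSum-++ K N) (trans (cong₂ _+_ K-sum N-sum) (sym (fibSum-++ L M))))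
      (begin
        length (K ++ N) * fib a             ≡⟨ cong (_* fib a) (length-++ K) ⟩
        (length K + length N) * fib a       ≡⟨ *-distribʳ-+ (fib a) (length K) _ ⟩
        length K * fib a + length N * fib a ≤⟨ +-mono-≤ K-len N-len ⟩
        generatorSum L + generatorSum M     ≡⟨ generatorSum-++ L M ⟨
        generatorSum (L ++ M)               ∎)
    where open ≤-Reasoning

  lower : ∀ L → Lowering L
  lower []      = lowering [] [] refl z≤n
  lower (i ∷ L) = lowering-++ (lower-index i) (lower L)

  remove-multiple : ∀ d {M} → All (_≤ suc a) M → d * fib a ≤ fibSum M → Removal 0 (d * fib a) M
  remove-multiple zero    _  _ = remove-nothing
  remove-multiple (suc d) M≤ h = r then remove-multiple d (bounded r M≤) (≤-fibSum-rest r h)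
    where r = remove-fib a M≤ (≤-trans (m≤m+n _ _) h)

  β-remainder≤length : ∀ {M} → All (_≤ suc a) M → β (fibSum M % fib a) ≤ length M
  β-remainder≤length {M} M≤ = ≤-trans (β-minimal (rest r) rest≡) (length-rest r)
    where
    r = remove-multiple (fibSum M / fib a) M≤ (m/n*n≤m (fibSum M) (fib a))
    rest≡ : fibSum (rest r) ≡ fibSum M % fib a
    rest≡ = +-cancelʳ-≡ _ _ _ (trans (fibSum-rest r) (m≡m%n+[m/n]*n (fibSum M) (fib a)))

  InS⇒β≤ : ∀ {x} → InS a x → β (x % fib a) ≤ x / fib a
  InS⇒β≤ s with InS⇒generatorSum s
  ... | L , refl = begin
    β (generatorSum L % fib a)     ≡⟨ cong β remainder≡ ⟩
    β (fibSum lowered % fib a)     ≤⟨ β-remainder≤length lowered-≤ ⟩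
    length lowered                 ≡⟨ m*n/n≡m (length lowered) (fib a) ⟨
    length lowered * fib a / fib a ≤⟨ /-monoˡ-≤ (fib a) length-lowered ⟩
    generatorSum L / fib a         ∎
    where
    open Lowering (lower L)
    open ≤-Reasoning
    remainder≡ : generatorSum L % fib a ≡ fibSum lowered % fib a
    remainder≡ = trans (cong (_% fib a) (+-comm _ (fibSum L)))
      (trans ([m+kn]%n≡m%n (fibSum L) (length L) (fib a)) (cong (_% fib a) (sym fibSum-lowered)))

  β≤⇒InS : ∀ {x} → β (x % fib a) ≤ x / fib a → InS a x
  β≤⇒InS {x} β≤ with β≤⇒indices β≤
  ... | L , L-sum , L-length = subst (InS a) generatorSum≡x (InS-generatorSum L)
    where
    generatorSum≡x : generatorSum L ≡ x
    generatorSum≡x = begin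
      length L * fib a + fibSum L   ≡⟨ cong₂ _+_ (cong (_* fib a) L-length) L-sum ⟩
      x / fib a * fib a + x % fib a ≡⟨ +-comm _ (x % fib a) ⟩
      x % fib a + x / fib a * fib a ≡⟨ m≡m%n+[m/n]*n x (fib a) ⟨
      x                             ∎
      where open ≡-Reasoning

  residueGaps : ℕ → List ℕ
  residueGaps r = map (λ q → q * fib a + r) (upTo (β r))

  gaps : ℕ → List ℕ
  gaps zero    = []
  gaps (suc m) = gaps m ++ residueGaps (suc m)

  length-gaps : ∀ m → length (gaps m) ≡ sumFrom1 β m
  length-gaps zero    = refl
  length-gaps (suc m) = trans (length-++ (gaps m))
    (cong₂ _+_ (length-gaps m) (trans (length-map _ (upTo (β (suc m)))) (length-upTo (β (suc m)))))

  ∈-residueGaps⁻ : ∀ {r x} → r < fib a → x ∈ residueGaps r → x % fib a ≡ r × x / fib a < β r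
  ∈-residueGaps⁻ r< x∈ with ∈-map⁻ (λ q → q * fib a + _) x∈
  ... | q , q∈ , refl = [q*n+r]%n≡r q r< , subst (_< _) (sym ([q*n+r]/n≡q q r<)) (∈-upTo⁻ q∈)

  ∈-residueGaps⁺ : ∀ {x} → x / fib a < β (x % fib a) → x ∈ residueGaps (x % fib a)
  ∈-residueGaps⁺ {x} q< =
    subst (_∈ residueGaps (x % fib a)) x≡ (∈-map⁺ (λ q → q * fib a + x % fib a) (∈-upTo⁺ q<))
    where
    x≡ : x / fib a * fib a + x % fib a ≡ x
    x≡ = trans (+-comm _ (x % fib a)) (sym (m≡m%n+[m/n]*n x (fib a)))

  ∈-gaps⁻ : ∀ m {x} → m < fib a → x ∈ gaps m → x % fib a ≤ m × x / fib a < β (x % fib a)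
  ∈-gaps⁻ (suc m) {x} m< x∈ with ∈-++⁻ (gaps m) x∈
  ... | inj₁ x∈gaps = let r≤ , q< = ∈-gaps⁻ m (<-trans (n<1+n m) m<) x∈gaps in m≤n⇒m≤1+n r≤ , q<
  ... | inj₂ x∈col  = let r≡ , q< = ∈-residueGaps⁻ m< x∈col in
                      ≤-reflexive r≡ , subst (λ r → x / fib a < β r) (sym r≡) q<

  ∈-gaps⁺ : ∀ m {x} → x % fib a ≤ m → x / fib a < β (x % fib a) → x ∈ gaps m
  ∈-gaps⁺ zero {x} r≤0 q< =
    contradiction (subst (x / fib a <_) (trans (cong β (n≤0⇒n≡0 r≤0)) β-zero) q<) λ ()
  ∈-gaps⁺ (suc m) r≤ q< with m≤n⇒m<n∨m≡n r≤
  ... | inj₁ r<  = ∈-++⁺ˡ (∈-gaps⁺ m (s≤s⁻¹ r<) q<)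
  ... | inj₂ r≡  = ∈-++⁺ʳ (gaps m) (subst (λ r → _ ∈ residueGaps r) r≡ (∈-residueGaps⁺ q<))

  residueGaps-unique : ∀ r → Unique (residueGaps r)
  residueGaps-unique r =
    Unique.map⁺ (λ e → *-cancelʳ-≡ _ _ (fib a) (+-cancelʳ-≡ r _ _ e)) (Unique.upTo⁺ (β r))

  gaps-unique : ∀ m → m < fib a → Unique (gaps m)
  gaps-unique zero    _  = Unique.[]
  gaps-unique (suc m) m< =
    Unique.++⁺ (gaps-unique m (<-trans (n<1+n m) m<)) (residueGaps-unique (suc m)) disjoint
    where
    disjoint : ∀ {x} → ¬ (x ∈ gaps m × x ∈ residueGaps (suc m))
    disjoint (x∈gaps , x∈col) =
      n≮n m (subst (_≤ m) (proj₁ (∈-residueGaps⁻ m< x∈col))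
                          (proj₁ (∈-gaps⁻ m (<-trans (n<1+n m) m<) x∈gaps)))

  genus : HasGenus (InS a) (sumFrom1 β (fib a ∸ 1))
  genus = gaps (fib a ∸ 1) ,
          gaps-unique (fib a ∸ 1) (n∸1<n (fib a)) ,
          (λ x → gap⇒∉S , ∉S⇒gap) ,
          length-gaps (fib a ∸ 1)
    where
    gap⇒∉S : ∀ {x} → x ∈ gaps (fib a ∸ 1) → ¬ InS a x
    gap⇒∉S x∈ x∈S = <⇒≱ (proj₂ (∈-gaps⁻ _ (n∸1<n (fib a)) x∈)) (InS⇒β≤ x∈S)
    ∉S⇒gap : ∀ {x} → ¬ InS a x → x ∈ gaps (fib a ∸ 1)
    ∉S⇒gap {x} x∉S = ∈-gaps⁺ _ (<⇒≤∸1 (m%n<n x (fib a))) (≰⇒> (x∉S ∘ β≤⇒InS))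

lemma31 : (a : ℕ) → 3 ≤ a →
    Σ (ℕ → ℕ) λ β → ((x : ℕ) → IsBeta x (β x)) ×
      HasGenus (InS a) (sumFrom1 β (fib a ∸ 1))
lemma31 a 3≤a = β , isBeta , genus
  where
  instance
    fib-a≢0 : NonZero (fib a)
    fib-a≢0 = >-nonZero (fib-mono {1} (≤-trans (s≤s z≤n) 3≤a))
  open Gaps a
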